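{- Let $n\ge1$, $N\ge1$ be integers and let $X_1,\dots,X_N\in H_{2n+1}(\mathbb{R})$. Then there exist $M\in\mathbb{N}$ and a sequence $a_1,\dots,a_M\in\{1,\dots,N\}$, depending only on $N$, in which each index $i\in\{1,\dots,N\}$ appears exactly $M/N$ times, such that $$X_{a_1}X_{a_2}\cdots X_{a_M}=\exp\Big(\frac{M}{N}\sum_{i=1}^N\log X_i\Big).$$
   Context: $H_{2n+1}(\mathbb{R})$ is the continuous Heisenberg group of $(n+2)\times(n+2)$ real matrices $\begin{pmatrix}1&\mathbf a&c\\0&I_n&\mathbf b\\0&0&1\end{pmatrix}$ ($\mathbf a$ a row vector, $\mathbf b$ a column vector in $\mathbb{R}^n$, $c\in\mathbb{R}$). For a unipotent upper triangular matrix $X$, $\log X=\sum_{k\ge1}(-1)^{k+1}(X-I)^k/k$ (a finite sum), and $\exp$ is the matrix exponential on strictly upper triangular matrices; they are mutually inverse. -}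

module Defs where

open import Level using (Level; _⊔_) renaming (suc to lsuc)
open import Algebra.Bundles using (CommutativeRing)
open import Data.Nat as ℕ using (ℕ; zero; suc)
open import Data.Fin as Fin using (Fin; zero; suc; _≟_)
open import Data.Sum using (_⊎_; inj₁; inj₂)
open import Data.Unit using (⊤; tt)
open import Data.List using (List; length; filter)
open import Data.List.Base using (allFin)
open import Relation.Nullary using (yes; no)

natR : ∀ {c ℓ} (R : CommutativeRing c ℓ) → ℕ → CommutativeRing.Carrier R
natR R zero = CommutativeRing.0# R
natR R (suc k) = CommutativeRing._+_ R (CommutativeRing.1# R) (natR R k)

-- A commutative ring in which every positive integer is invertible
-- (a ℚ-algebra); ℝ is an instance.  Needed to form 1/k and 1/k! in log, exp.
record QAlgebra (c ℓ : Level) : Set (lsuc (c ⊔ ℓ)) where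
  field
    ring    : CommutativeRing c ℓ
    inv     : ℕ → CommutativeRing.Carrier ring      -- inv k = 1 / (k+1)
    inv-law : ∀ k → CommutativeRing._≈_ ring
                (CommutativeRing._*_ ring (natR ring (suc k)) (inv k))
                (CommutativeRing.1# ring)
  natC : ℕ → CommutativeRing.Carrier ring
  natC = natR ring

count : ∀ {M N} → (Fin M → Fin N) → Fin N → ℕ
count {M} a i = length (filter (λ j → a j ≟ i) (allFin M))

classify : ∀ {n} → Fin (suc n) → Fin n ⊎ ⊤
classify {zero} zero = inj₂ tt
classify {suc n} zero = inj₁ zero
classify {suc n} (suc k) with classify k
... | inj₁ m = inj₁ (suc m)
... | inj₂ t = inj₂ t

module Over {c ℓ} (R : QAlgebra c ℓ) where
  open QAlgebra R
  open CommutativeRing ring hiding (zero)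

  Mat : ℕ → Set c
  Mat d = Fin d → Fin d → Carrier

  sumF : ∀ {k} → (Fin k → Carrier) → Carrier
  sumF {zero} f = 0#
  sumF {suc k} f = f zero + sumF (λ i → f (suc i))

  _≈M_ : ∀ {d} → Mat d → Mat d → Set ℓ
  A ≈M B = ∀ i j → A i j ≈ B i j

  idM : ∀ {d} → Mat d
  idM i j with i ≟ j
  ... | yes _ = 1#
  ... | no _ = 0#

  zeroM : ∀ {d} → Mat d
  zeroM i j = 0#

  _+M_ : ∀ {d} → Mat d → Mat d → Mat d
  (A +M B) i j = A i j + B i j

  _-M_ : ∀ {d} → Mat d → Mat d → Mat d
  (A -M B) i j = A i j - B i j

  _*M_ : ∀ {d} → Mat d → Mat d → Mat d
  (A *M B) i j = sumF (λ k → A i k * B k j)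

  _·M_ : ∀ {d} → Carrier → Mat d → Mat d
  (s ·M A) i j = s * A i j

  powM : ∀ {d} → Mat d → ℕ → Mat d
  powM A zero = idM
  powM A (suc k) = A *M powM A k

  sumM : ∀ {d k} → (Fin k → Mat d) → Mat d
  sumM {k = zero} f = zeroM
  sumM {k = suc k} f = f zero +M sumM (λ i → f (suc i))

  prodM : ∀ {d M} → (Fin M → Mat d) → Mat d
  prodM {M = zero} f = idM
  prodM {M = suc M} f = f zero *M prodM (λ i → f (suc i))

  invFact : ℕ → Carrier
  invFact zero = 1#
  invFact (suc k) = inv k * invFact k

  -- exp Y = Σ_{k=0}^{d-1} Y^k / k!  (exact for strictly upper triangular d×d Y,
  -- since then Y^d = 0)
  expM : ∀ {d} → Mat d → Mat d
  expM {d} Y = sumM {k = d} (λ k → invFact (Fin.toℕ k) ·M powM Y (Fin.toℕ k))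

  sign : ℕ → Carrier
  sign zero = 1#
  sign (suc k) = - sign k

  -- log X = Σ_{k=1}^{d} (-1)^{k+1} (X - I)^k / k  (finite for unipotent X,
  -- since (X-I)^d = 0)
  logM : ∀ {d} → Mat d → Mat d
  logM {d} X = sumM {k = d}
    (λ k → (sign (Fin.toℕ k) * inv (Fin.toℕ k)) ·M powM (X -M idM) (suc (Fin.toℕ k)))

  -- the Heisenberg matrix  [[1, a, c], [0, I_n, b], [0, 0, 1]]  of size n+2
  heis : ∀ {n} → (Fin n → Carrier) → (Fin n → Carrier) → Carrier → Mat (suc (suc n))
  heis a b c zero zero = 1#
  heis a b c zero (suc l) with classify l
  ... | inj₁ m = a m
  ... | inj₂ _ = c
  heis a b c (suc k) zero = 0#
  heis a b c (suc k) (suc l) with classify k | classify l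
  ... | inj₁ m | inj₁ m' = idM m m'
  ... | inj₁ m | inj₂ _ = b m
  ... | inj₂ _ | inj₁ _ = 0#
  ... | inj₂ _ | inj₂ _ = 1#

-- A matrix of the Heisenberg shape [[e, a, c], [0, e I, b], [0, 0, e]] is determined by (e, a, b, c),
-- and sums, differences, scalar multiples and products of such matrices are again of this shape, with
-- explicit coordinates.  For unipotent X = (1, a, b, c) the matrix X − I squares to (0, 0, 0, a·b) and
-- cubes to zero, so log X = (0, a, b, c − a·b/2), and dually exp (0, a, b, c) = (1, a, b, c + a·b/2).
-- A product X₁ ⋯ X_M has coordinates (Σ aᵢ, Σ bᵢ, Σ cᵢ + Σ_{i<j} aᵢ·bⱼ).  Along the palindrome
-- L ++ reverse L with L = 1, …, N, the cross term is cross L + cross (reverse L) + (Σ aᵢ)·(Σ bⱼ), and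
-- the first two together run over all off-diagonal pairs, so it equals 2 (Σ aᵢ)·(Σ bⱼ) − Σ aᵢ·bᵢ:
-- exactly what the c-coordinate of exp (2 Σ log Xᵢ) needs.  So M = 2N works, each index occurring twice.

module Submission where

open import Defs
open import Algebra.Bundles using (CommutativeRing)
open import Data.Nat.Base as ℕ using (ℕ; zero; suc)
open import Data.Fin.Base using (Fin; zero; suc; inject₁; fromℕ; toℕ)
open import Data.Fin.Properties using (_≟_; suc-injective; inject₁-injective; fromℕ≢inject₁)
open import Data.Fin.Relation.Unary.Top using (view; ‵fromℕ; ‵inject₁)
open import Data.List.Base using (List; []; _∷_; _++_; reverse; length; filter; map; lookup; tabulate; allFin)
open import Data.List.Properties
  using (unfold-reverse; filter-++; length-++; length-reverse; length-tabulate; map-tabulate; tabulate-lookup)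
open import Data.List.Relation.Binary.Permutation.Propositional.Properties using (↭-length; filter-↭; ↭-reverse)
open import Data.Product.Base using (Σ; _×_; _,_)
open import Data.Sum.Base using (inj₁; inj₂)
open import Data.Unit.Base using (tt)
open import Data.Vec.Functional using (Vector)
open import Data.Bool.Base using (true; false)
open import Function.Base using (_∘_)
open import Relation.Nullary using (¬_; Dec; yes; no; does; contradiction)
open import Relation.Binary.PropositionalEquality as ≡ using (_≡_)

classify-inject₁ : ∀ {n} (m : Fin n) → classify (inject₁ m) ≡ inj₁ m
classify-inject₁ {suc n} zero = ≡.refl
classify-inject₁ {suc n} (suc m) rewrite classify-inject₁ m = ≡.refl

classify-fromℕ : ∀ n → classify (fromℕ n) ≡ inj₂ tt
classify-fromℕ zero = ≡.refl
classify-fromℕ (suc n) rewrite classify-fromℕ n = ≡.refl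

data Position {n : ℕ} : Fin (suc (suc n)) → Set where
  ‵top : Position zero
  ‵mid : ∀ m → Position (suc (inject₁ m))
  ‵bot : Position (suc (fromℕ n))

position : ∀ {n} (i : Fin (suc (suc n))) → Position i
position zero = ‵top
position (suc k) with view k
... | ‵fromℕ = ‵bot
... | ‵inject₁ m = ‵mid m

palindrome : ∀ N → List (Fin N)
palindrome N = allFin N ++ reverse (allFin N)

module Heisenberg {c ℓ} (R : QAlgebra c ℓ) where
  open QAlgebra R using (inv; inv-law; natC) renaming (ring to CR)
  open CommutativeRing CR hiding (zero)
  open Over R
  open import Algebra.Solver.Ring.NaturalCoefficients.Default commutativeSemiring
  open import Algebra.Properties.Ring ring using (-‿distribˡ-*; -1*x≈-x)
  open import Algebra.Properties.AbelianGroup +-abelianGroup using (⁻¹-∙-comm)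
  open import Data.Vec.Functional.Relation.Binary.Equality.Setoid setoid using (_≋_; ≋-refl)
  open import Relation.Binary.Reasoning.Setoid setoid

  sumF-cong : ∀ {k} {f g : Vector Carrier k} → f ≋ g → sumF f ≈ sumF g
  sumF-cong {zero} f≋g = refl
  sumF-cong {suc k} f≋g = +-cong (f≋g zero) (sumF-cong (f≋g ∘ suc))

  sumF-zero : ∀ {k} {f : Vector Carrier k} → (∀ i → f i ≈ 0#) → sumF f ≈ 0#
  sumF-zero {zero} f≈0 = refl
  sumF-zero {suc k} f≈0 = trans (+-cong (f≈0 zero) (sumF-zero (f≈0 ∘ suc))) (+-identityʳ 0#)

  sumF-distrib-+ : ∀ {k} (f g : Vector Carrier k) → sumF (λ i → f i + g i) ≈ sumF f + sumF g
  sumF-distrib-+ {zero} f g = sym (+-identityʳ 0#)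
  sumF-distrib-+ {suc k} f g = trans (+-cong refl (sumF-distrib-+ (f ∘ suc) (g ∘ suc)))
    (solve 4 (λ a b x y → (a :+ b) :+ (x :+ y) := (a :+ x) :+ (b :+ y)) refl (f zero) (g zero) _ _)

  *-distribˡ-sumF : ∀ {k} s (f : Vector Carrier k) → s * sumF f ≈ sumF (λ i → s * f i)
  *-distribˡ-sumF {zero} s f = zeroʳ s
  *-distribˡ-sumF {suc k} s f = trans (distribˡ s _ _) (+-cong refl (*-distribˡ-sumF s (f ∘ suc)))

  -‿distrib-sumF : ∀ {k} (f : Vector Carrier k) → - sumF f ≈ sumF (λ i → - f i)
  -‿distrib-sumF {zero} f = trans (sym (+-identityˡ (- 0#))) (-‿inverseʳ 0#)
  -‿distrib-sumF {suc k} f = trans (sym (⁻¹-∙-comm _ _)) (+-cong refl (-‿distrib-sumF (f ∘ suc)))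

  sumF-init-last : ∀ k (f : Vector Carrier (suc k)) → sumF f ≈ sumF (f ∘ inject₁) + f (fromℕ k)
  sumF-init-last zero f = trans (+-identityʳ _) (sym (+-identityˡ _))
  sumF-init-last (suc k) f = trans (+-cong refl (sumF-init-last k (f ∘ suc))) (sym (+-assoc _ _ _))

  idM-diag : ∀ {k} (i : Fin k) → idM i i ≈ 1#
  idM-diag i with i ≟ i
  ... | yes _ = refl
  ... | no i≢i = contradiction ≡.refl i≢i

  idM-off : ∀ {k} {i j : Fin k} → ¬ i ≡ j → idM i j ≈ 0#
  idM-off {i = i} {j} i≢j with i ≟ j
  ... | yes i≡j = contradiction i≡j i≢j
  ... | no _ = refl

  idM-injective : ∀ {k k′} (f : Fin k → Fin k′) → (∀ {i j} → f i ≡ f j → i ≡ j) →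
                  ∀ i j → idM (f i) (f j) ≈ idM i j
  idM-injective f f-inj i j = by-cases (i ≟ j)
    where
    by-cases : Dec (i ≡ j) → idM (f i) (f j) ≈ idM i j
    by-cases (yes ≡.refl) = trans (idM-diag (f i)) (sym (idM-diag i))
    by-cases (no i≢j) = trans (idM-off (i≢j ∘ f-inj)) (sym (idM-off i≢j))

  idM-sym : ∀ {k} (i j : Fin k) → idM i j ≈ idM j i
  idM-sym i j with i ≟ j | j ≟ i
  ... | yes _ | yes _ = refl
  ... | no _ | no _ = refl
  ... | yes i≡j | no j≢i = contradiction (≡.sym i≡j) j≢i
  ... | no i≢j | yes j≡i = contradiction (≡.sym j≡i) i≢j

  sumF-δʳ : ∀ {k} (v : Vector Carrier k) j → sumF (λ i → v i * idM i j) ≈ v j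
  sumF-δʳ {suc k} v zero = trans (+-cong (*-identityʳ _) (sumF-zero {k} (λ i → zeroʳ _))) (+-identityʳ _)
  sumF-δʳ {suc k} v (suc j) = trans (+-cong (zeroʳ _)
      (trans (sumF-cong (λ i → *-cong refl (idM-injective suc suc-injective i j))) (sumF-δʳ (v ∘ suc) j)))
    (+-identityˡ _)

  sumF-δˡ : ∀ {k} (v : Vector Carrier k) i → sumF (λ j → idM i j * v j) ≈ v i
  sumF-δˡ {k} v i = trans (sumF-cong {k} (λ j → trans (*-comm _ _) (*-cong refl (idM-sym i j)))) (sumF-δʳ v i)

  sumF-scaled-δˡ : ∀ {k} s (v : Vector Carrier k) i → sumF (λ j → (s * idM i j) * v j) ≈ s * v i
  sumF-scaled-δˡ {k} s v i =
    trans (sumF-cong {k} (λ j → *-assoc _ _ _)) (trans (sym (*-distribˡ-sumF {k} s _)) (*-cong refl (sumF-δˡ v i)))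

  sumF-scaled-δʳ : ∀ {k} s (v : Vector Carrier k) j → sumF (λ i → v i * (s * idM i j)) ≈ v j * s
  sumF-scaled-δʳ {k} s v j =
    trans (sumF-cong {k} (λ i → trans (*-comm _ _) (*-assoc _ _ _))) (trans (sym (*-distribˡ-sumF {k} s _))
      (trans (*-cong refl (trans (sumF-cong {k} (λ i → *-comm _ _)) (sumF-δʳ v j))) (*-comm _ _)))

  dot : ∀ {k} → Vector Carrier k → Vector Carrier k → Carrier
  dot x y = sumF (λ m → x m * y m)

  dot-cong : ∀ {k} {x x′ y y′ : Vector Carrier k} → x ≋ x′ → y ≋ y′ → dot x y ≈ dot x′ y′
  dot-cong {k} x≋x′ y≋y′ = sumF-cong {k} (λ m → *-cong (x≋x′ m) (y≋y′ m))

  dot-distribʳ-+ : ∀ {k} (x x′ y : Vector Carrier k) → dot (λ m → x m + x′ m) y ≈ dot x y + dot x′ y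
  dot-distribʳ-+ {k} x x′ y = trans (sumF-cong {k} (λ m → distribʳ _ _ _)) (sumF-distrib-+ {k} _ _)

  dot-distribˡ-+ : ∀ {k} (x y y′ : Vector Carrier k) → dot x (λ m → y m + y′ m) ≈ dot x y + dot x y′
  dot-distribˡ-+ {k} x y y′ = trans (sumF-cong {k} (λ m → distribˡ _ _ _)) (sumF-distrib-+ {k} _ _)

  dot-*ˡ : ∀ {k} s (x y : Vector Carrier k) → dot (λ m → s * x m) y ≈ s * dot x y
  dot-*ˡ {k} s x y = trans (sumF-cong {k} (λ m → *-assoc _ _ _)) (sym (*-distribˡ-sumF {k} s _))

  dot-*ʳ : ∀ {k} s (x y : Vector Carrier k) → dot x (λ m → s * y m) ≈ s * dot x y
  dot-*ʳ {k} s x y = trans (sumF-cong {k} (λ m → x*[s*y]≈s*[x*y] (x m) (y m))) (sym (*-distribˡ-sumF {k} s _))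
    where
    x*[s*y]≈s*[x*y] : ∀ x y → x * (s * y) ≈ s * (x * y)
    x*[s*y]≈s*[x*y] x y = trans (sym (*-assoc _ _ _)) (trans (*-cong (*-comm x s) refl) (*-assoc _ _ _))

  dot-zeroˡ : ∀ {k} (y : Vector Carrier k) → dot (λ _ → 0#) y ≈ 0#
  dot-zeroˡ {k} y = sumF-zero {k} (λ m → zeroˡ _)

  dot-zeroʳ : ∀ {k} (x : Vector Carrier k) → dot x (λ _ → 0#) ≈ 0#
  dot-zeroʳ {k} x = sumF-zero {k} (λ m → zeroʳ _)

  ≈M-trans : ∀ {d} {X Y Z : Mat d} → X ≈M Y → Y ≈M Z → X ≈M Z
  ≈M-trans X≈Y Y≈Z i j = trans (X≈Y i j) (Y≈Z i j)

  *M-congˡ : ∀ {d} (X : Mat d) {Y Y′ : Mat d} → Y ≈M Y′ → (X *M Y) ≈M (X *M Y′)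
  *M-congˡ {d} X Y≈Y′ i j = sumF-cong {d} (λ k → *-cong refl (Y≈Y′ k j))

  *M-zeroʳ : ∀ {d} (X : Mat d) → (X *M zeroM) ≈M zeroM
  *M-zeroʳ {d} X i j = sumF-zero {d} (λ k → zeroʳ _)

  *M-identityʳ : ∀ {d} (X : Mat d) → (X *M idM) ≈M X
  *M-identityʳ X i j = sumF-δʳ (X i) j

  ·M-zero : ∀ {d} s {X : Mat d} → X ≈M zeroM → (s ·M X) ≈M zeroM
  ·M-zero s X≈0 i j = trans (*-cong refl (X≈0 i j)) (zeroʳ s)

  sumM-zero : ∀ {d k} (f : Fin k → Mat d) → (∀ i → f i ≈M zeroM) → sumM f ≈M zeroM
  sumM-zero {k = zero} f f≈0 i j = refl
  sumM-zero {k = suc k} f f≈0 i j =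
    trans (+-cong (f≈0 zero i j) (sumM-zero (f ∘ suc) (f≈0 ∘ suc) i j)) (+-identityʳ 0#)

  module _ {n : ℕ} where

    top bot : Fin (suc (suc n))
    top = zero
    bot = suc (fromℕ n)

    mid : Fin n → Fin (suc (suc n))
    mid m = suc (inject₁ m)

    record IsHeis (e : Carrier) (X : Mat (suc (suc n))) (a b : Vector Carrier n) (c : Carrier) : Set ℓ where
      field
        top-top : X top top ≈ e
        top-mid : ∀ m → X top (mid m) ≈ a m
        top-bot : X top bot ≈ c
        mid-top : ∀ m → X (mid m) top ≈ 0#
        mid-mid : ∀ m m′ → X (mid m) (mid m′) ≈ e * idM m m′
        mid-bot : ∀ m → X (mid m) bot ≈ b m
        bot-top : X bot top ≈ 0#
        bot-mid : ∀ m → X bot (mid m) ≈ 0#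
        bot-bot : X bot bot ≈ e
    open IsHeis

    IsHeis-unique : ∀ {e X Y a b c} → IsHeis e X a b c → IsHeis e Y a b c → X ≈M Y
    IsHeis-unique {X = X} {Y} H H′ i j = by-position (position i) (position j)
      where
      agree : ∀ {i j x} → X i j ≈ x → Y i j ≈ x → X i j ≈ Y i j
      agree X≈x Y≈x = trans X≈x (sym Y≈x)

      by-position : ∀ {i j} → Position i → Position j → X i j ≈ Y i j
      by-position ‵top ‵top = agree (top-top H) (top-top H′)
      by-position ‵top (‵mid m) = agree (top-mid H m) (top-mid H′ m)
      by-position ‵top ‵bot = agree (top-bot H) (top-bot H′)
      by-position (‵mid m) ‵top = agree (mid-top H m) (mid-top H′ m)
      by-position (‵mid m) (‵mid m′) = agree (mid-mid H m m′) (mid-mid H′ m m′)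
      by-position (‵mid m) ‵bot = agree (mid-bot H m) (mid-bot H′ m)
      by-position ‵bot ‵top = agree (bot-top H) (bot-top H′)
      by-position ‵bot (‵mid m) = agree (bot-mid H m) (bot-mid H′ m)
      by-position ‵bot ‵bot = agree (bot-bot H) (bot-bot H′)

    IsHeis-resp-≈M : ∀ {e X Y a b c} → X ≈M Y → IsHeis e Y a b c → IsHeis e X a b c
    IsHeis-resp-≈M X≈Y H = record
      { top-top = trans (X≈Y _ _) (top-top H) ; top-mid = λ m → trans (X≈Y _ _) (top-mid H m)
      ; top-bot = trans (X≈Y _ _) (top-bot H) ; mid-top = λ m → trans (X≈Y _ _) (mid-top H m)
      ; mid-mid = λ m m′ → trans (X≈Y _ _) (mid-mid H m m′) ; mid-bot = λ m → trans (X≈Y _ _) (mid-bot H m)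
      ; bot-top = trans (X≈Y _ _) (bot-top H) ; bot-mid = λ m → trans (X≈Y _ _) (bot-mid H m)
      ; bot-bot = trans (X≈Y _ _) (bot-bot H) }

    IsHeis-cong : ∀ {e e′ X a a′ b b′ c c′} → IsHeis e X a b c →
                  e ≈ e′ → a ≋ a′ → b ≋ b′ → c ≈ c′ → IsHeis e′ X a′ b′ c′
    IsHeis-cong H e≈e′ a≋a′ b≋b′ c≈c′ = record
      { top-top = trans (top-top H) e≈e′ ; top-mid = λ m → trans (top-mid H m) (a≋a′ m)
      ; top-bot = trans (top-bot H) c≈c′ ; mid-top = mid-top H
      ; mid-mid = λ m m′ → trans (mid-mid H m m′) (*-cong e≈e′ refl)
      ; mid-bot = λ m → trans (mid-bot H m) (b≋b′ m)
      ; bot-top = bot-top H ; bot-mid = bot-mid H ; bot-bot = trans (bot-bot H) e≈e′ }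

    IsHeis-idM : IsHeis 1# idM (λ _ → 0#) (λ _ → 0#) 0#
    IsHeis-idM = record
      { top-top = refl ; top-mid = λ m → refl ; top-bot = refl ; mid-top = λ m → refl
      ; mid-mid = λ m m′ → trans (idM-injective mid (inject₁-injective ∘ suc-injective) m m′)
                                  (sym (*-identityˡ _))
      ; mid-bot = λ m → idM-off {i = mid m} {bot} (fromℕ≢inject₁ ∘ ≡.sym ∘ suc-injective)
      ; bot-top = refl ; bot-mid = λ m → idM-off {i = bot} {mid m} (fromℕ≢inject₁ ∘ suc-injective)
      ; bot-bot = idM-diag bot }

    IsHeis-zeroM : IsHeis 0# zeroM (λ _ → 0#) (λ _ → 0#) 0#
    IsHeis-zeroM = record
      { top-top = refl ; top-mid = λ m → refl ; top-bot = refl ; mid-top = λ m → refl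
      ; mid-mid = λ m m′ → sym (zeroˡ _) ; mid-bot = λ m → refl
      ; bot-top = refl ; bot-mid = λ m → refl ; bot-bot = refl }

    IsHeis-heis : ∀ a b c → IsHeis 1# (heis a b c) a b c
    IsHeis-heis a b c = record
      { top-top = refl ; top-mid = top-mid′ ; top-bot = top-bot′ ; mid-top = λ m → refl
      ; mid-mid = mid-mid′ ; mid-bot = mid-bot′ ; bot-top = refl ; bot-mid = bot-mid′ ; bot-bot = bot-bot′ }
      where
      top-mid′ : ∀ m → heis a b c top (mid m) ≈ a m
      top-mid′ m rewrite classify-inject₁ m = refl
      top-bot′ : heis a b c top bot ≈ c
      top-bot′ rewrite classify-fromℕ n = refl
      mid-mid′ : ∀ m m′ → heis a b c (mid m) (mid m′) ≈ 1# * idM m m′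
      mid-mid′ m m′ rewrite classify-inject₁ m | classify-inject₁ m′ = sym (*-identityˡ _)
      mid-bot′ : ∀ m → heis a b c (mid m) bot ≈ b m
      mid-bot′ m rewrite classify-inject₁ m | classify-fromℕ n = refl
      bot-mid′ : ∀ m → heis a b c bot (mid m) ≈ 0#
      bot-mid′ m rewrite classify-inject₁ m | classify-fromℕ n = refl
      bot-bot′ : heis a b c bot bot ≈ 1#
      bot-bot′ rewrite classify-fromℕ n = refl

    *M-entry : ∀ (X Y : Mat (suc (suc n))) i j → (X *M Y) i j ≈
               X i top * Y top j + (sumF (λ m → X i (mid m) * Y (mid m) j) + X i bot * Y bot j)
    *M-entry X Y i j = +-cong refl (sumF-init-last n (λ k → X i (suc k) * Y (suc k) j))

    IsHeis-*M : ∀ {e e′ X Y a a′ b b′ c c′} → IsHeis e X a b c → IsHeis e′ Y a′ b′ c′ →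
                IsHeis (e * e′) (X *M Y) (λ m → e * a′ m + a m * e′) (λ m → e * b′ m + b m * e′)
                       (e * c′ + dot a b′ + c * e′)
    IsHeis-*M {e} {e′} {X} {Y} {a} {a′} {b} {b′} {c} {c′} H H′ = record
      { top-top = entry (*-cong (top-top H) (top-top H′)) (sumF-zero {n} (λ m → *0 (mid-top H′ m)))
                  (*0 (bot-top H′))
                  (trans (+-cong refl (+-identityʳ 0#)) (+-identityʳ _))
      ; top-mid = λ m′ → entry (*-cong (top-top H) (top-mid H′ m′))
                  (trans (sumF-cong {n} (λ m → *-cong (top-mid H m) (mid-mid H′ m m′))) (sumF-scaled-δʳ e′ a m′))
                  (*0 (bot-mid H′ m′)) (+-cong refl (+-identityʳ _))
      ; top-bot = entry (*-cong (top-top H) (top-bot H′))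
                  (sumF-cong {n} (λ m → *-cong (top-mid H m) (mid-bot H′ m)))
                  (*-cong (top-bot H) (bot-bot H′)) (sym (+-assoc _ _ _))
      ; mid-top = λ m → entry (0* (mid-top H m)) (sumF-zero {n} (λ k → *0 (mid-top H′ k))) (*0 (bot-top H′))
                  0+[0+x]≈x
      ; mid-mid = λ m m′ → entry (0* (mid-top H m))
                  (trans (sumF-cong {n} (λ k → *-cong (mid-mid H m k) (mid-mid H′ k m′)))
                    (sumF-scaled-δˡ e (λ k → e′ * idM k m′) m))
                  (*0 (bot-mid H′ m′)) (trans (+-identityˡ _) (trans (+-identityʳ _) (sym (*-assoc _ _ _))))
      ; mid-bot = λ m → entry (0* (mid-top H m))
                  (trans (sumF-cong {n} (λ k → *-cong (mid-mid H m k) (mid-bot H′ k))) (sumF-scaled-δˡ e b′ m))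
                  (*-cong (mid-bot H m) (bot-bot H′)) (+-identityˡ _)
      ; bot-top = entry (0* (bot-top H)) (sumF-zero {n} (λ k → 0* (bot-mid H k))) (*0 (bot-top H′)) 0+[0+x]≈x
      ; bot-mid = λ m′ → entry (0* (bot-top H)) (sumF-zero {n} (λ k → 0* (bot-mid H k))) (*0 (bot-mid H′ m′))
                  0+[0+x]≈x
      ; bot-bot = entry (0* (bot-top H)) (sumF-zero {n} (λ k → 0* (bot-mid H k)))
                  (*-cong (bot-bot H) (bot-bot H′))
                  0+[0+x]≈x
      }
      where
      entry : ∀ {i j t′ s′ u′ x} → X i top * Y top j ≈ t′ →
              sumF (λ m → X i (mid m) * Y (mid m) j) ≈ s′ → X i bot * Y bot j ≈ u′ →
              t′ + (s′ + u′) ≈ x → (X *M Y) i j ≈ x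
      entry {i} {j} t≈ s≈ u≈ simplify =
        trans (*M-entry X Y i j) (trans (+-cong t≈ (+-cong s≈ u≈)) simplify)
      *0 : ∀ {x y} → y ≈ 0# → x * y ≈ 0#
      *0 y≈0 = trans (*-cong refl y≈0) (zeroʳ _)
      0* : ∀ {x y} → x ≈ 0# → x * y ≈ 0#
      0* x≈0 = trans (*-cong x≈0 refl) (zeroˡ _)
      0+[0+x]≈x : ∀ {x} → 0# + (0# + x) ≈ x
      0+[0+x]≈x = trans (+-identityˡ _) (+-identityˡ _)

    IsHeis-+M : ∀ {e e′ X Y a a′ b b′ c c′} → IsHeis e X a b c → IsHeis e′ Y a′ b′ c′ →
                IsHeis (e + e′) (X +M Y) (λ m → a m + a′ m) (λ m → b m + b′ m) (c + c′)
    IsHeis-+M H H′ = record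
      { top-top = +-cong (top-top H) (top-top H′) ; top-mid = λ m → +-cong (top-mid H m) (top-mid H′ m)
      ; top-bot = +-cong (top-bot H) (top-bot H′) ; mid-top = λ m → 0+0 (mid-top H m) (mid-top H′ m)
      ; mid-mid = λ m m′ → trans (+-cong (mid-mid H m m′) (mid-mid H′ m m′)) (sym (distribʳ _ _ _))
      ; mid-bot = λ m → +-cong (mid-bot H m) (mid-bot H′ m) ; bot-top = 0+0 (bot-top H) (bot-top H′)
      ; bot-mid = λ m → 0+0 (bot-mid H m) (bot-mid H′ m) ; bot-bot = +-cong (bot-bot H) (bot-bot H′) }
      where
      0+0 : ∀ {x y} → x ≈ 0# → y ≈ 0# → x + y ≈ 0#
      0+0 x≈0 y≈0 = trans (+-cong x≈0 y≈0) (+-identityʳ 0#)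

    IsHeis-·M : ∀ s {e X a b c} → IsHeis e X a b c →
                IsHeis (s * e) (s ·M X) (λ m → s * a m) (λ m → s * b m) (s * c)
    IsHeis-·M s H = record
      { top-top = *-cong refl (top-top H) ; top-mid = λ m → *-cong refl (top-mid H m)
      ; top-bot = *-cong refl (top-bot H) ; mid-top = λ m → s*0 (mid-top H m)
      ; mid-mid = λ m m′ → trans (*-cong refl (mid-mid H m m′)) (sym (*-assoc _ _ _))
      ; mid-bot = λ m → *-cong refl (mid-bot H m) ; bot-top = s*0 (bot-top H)
      ; bot-mid = λ m → s*0 (bot-mid H m) ; bot-bot = *-cong refl (bot-bot H) }
      where
      s*0 : ∀ {x} → x ≈ 0# → s * x ≈ 0#
      s*0 x≈0 = trans (*-cong refl x≈0) (zeroʳ s)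

    IsHeis--M : ∀ {e e′ X Y a a′ b b′ c c′} → IsHeis e X a b c → IsHeis e′ Y a′ b′ c′ →
                IsHeis (e - e′) (X -M Y) (λ m → a m - a′ m) (λ m → b m - b′ m) (c - c′)
    IsHeis--M H H′ = record
      { top-top = −-cong (top-top H) (top-top H′) ; top-mid = λ m → −-cong (top-mid H m) (top-mid H′ m)
      ; top-bot = −-cong (top-bot H) (top-bot H′) ; mid-top = λ m → 0-0 (mid-top H m) (mid-top H′ m)
      ; mid-mid = λ m m′ → trans (−-cong (mid-mid H m m′) (mid-mid H′ m m′))
                              (trans (+-cong refl (-‿distribˡ-* _ _)) (sym (distribʳ _ _ _)))
      ; mid-bot = λ m → −-cong (mid-bot H m) (mid-bot H′ m) ; bot-top = 0-0 (bot-top H) (bot-top H′)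
      ; bot-mid = λ m → 0-0 (bot-mid H m) (bot-mid H′ m) ; bot-bot = −-cong (bot-bot H) (bot-bot H′) }
      where
      −-cong : ∀ {x x′ y y′} → x ≈ x′ → y ≈ y′ → x - y ≈ x′ - y′
      −-cong x≈x′ y≈y′ = +-cong x≈x′ (-‿cong y≈y′)
      0-0 : ∀ {x y} → x ≈ 0# → y ≈ 0# → x - y ≈ 0#
      0-0 x≈0 y≈0 = trans (−-cong x≈0 y≈0) (-‿inverseʳ 0#)

    IsHeis-sumM : ∀ {k} (f : Fin k → Mat (suc (suc n))) (a b : Fin k → Vector Carrier n) (c : Vector Carrier k) →
                  (∀ i → IsHeis 0# (f i) (a i) (b i) (c i)) →
                  IsHeis 0# (sumM f) (λ m → sumF (λ i → a i m)) (λ m → sumF (λ i → b i m)) (sumF c)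
    IsHeis-sumM {zero} f a b c H = IsHeis-zeroM
    IsHeis-sumM {suc k} f a b c H =
      IsHeis-cong (IsHeis-+M (H zero) (IsHeis-sumM (f ∘ suc) (a ∘ suc) (b ∘ suc) (c ∘ suc) (H ∘ suc)))
                  (+-identityˡ 0#) (λ m → refl) (λ m → refl) refl

    module Nilpotent {Y a b c} (H : IsHeis 0# Y a b c) where

      0*x+y*0 : ∀ x y → 0# * x + y * 0# ≈ 0#
      0*x+y*0 x y = trans (+-cong (zeroˡ x) (zeroʳ y)) (+-identityʳ 0#)

      IsHeis-powM-1 : IsHeis 0# (powM Y 1) a b c
      IsHeis-powM-1 = IsHeis-resp-≈M (*M-identityʳ Y) H

      IsHeis-powM-2 : IsHeis 0# (powM Y 2) (λ _ → 0#) (λ _ → 0#) (dot a b)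
      IsHeis-powM-2 = IsHeis-cong (IsHeis-*M H IsHeis-powM-1) (zeroˡ 0#)
        (λ m → 0*x+y*0 (a m) (a m)) (λ m → 0*x+y*0 (b m) (b m))
        (trans (+-cong (+-cong (zeroˡ c) refl) (zeroʳ c)) (trans (+-identityʳ _) (+-identityˡ _)))

      powM-3 : powM Y 3 ≈M zeroM
      powM-3 = IsHeis-unique
        (IsHeis-cong (IsHeis-*M H IsHeis-powM-2) (zeroˡ 0#) (λ m → 0*x+y*0 0# (a m)) (λ m → 0*x+y*0 0# (b m))
          (trans (+-cong (+-cong refl (dot-zeroʳ a)) refl) (trans (+-cong (+-identityʳ _) refl) (0*x+y*0 _ c))))
        IsHeis-zeroM

      powM-vanishes : ∀ k → powM Y (3 ℕ.+ k) ≈M zeroM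
      powM-vanishes zero = powM-3
      powM-vanishes (suc k) = ≈M-trans (*M-congˡ Y (powM-vanishes k)) (*M-zeroʳ Y)

  half : Carrier
  half = inv 1

  two*x≈x+x : ∀ x → natC 2 * x ≈ x + x
  two*x≈x+x x = trans (distribʳ _ _ _) (+-cong (*-identityˡ x)
    (trans (distribʳ _ _ _) (trans (+-cong (*-identityˡ x) (zeroˡ x)) (+-identityʳ x))))

  half+half≈1 : half + half ≈ 1#
  half+half≈1 = trans (sym (two*x≈x+x half)) (inv-law 1)

  -- With X = 2P − Δ: the c-coordinates 2S + 2P − Δ of the palindromic product and
  -- 2 (S − Δ/2) + (2·2P)/2 of exp (2 Σ log Xᵢ) agree.
  halving-identity : ∀ {S P Δ X} → X + Δ ≈ P + P →
                     (S + S) + X ≈ natC 2 * (S - half * Δ) + half * (natC 2 * (natC 2 * P))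
  halving-identity {S} {P} {Δ} {X} X+Δ≈2P = begin
    (S + S) + X
      ≈⟨ +-cong refl X≈2P-Δ ⟩
    (S + S) + ((P + P) - Δ)
      ≈⟨ +-cong refl (+-cong (*-identityʳ _) (-‿cong (*-identityˡ Δ))) ⟨
    (S + S) + ((P + P) * 1# - 1# * Δ)
      ≈⟨ +-cong refl (+-cong (*-cong refl half+half≈1) (-‿cong (*-cong half+half≈1 refl))) ⟨
    (S + S) + ((P + P) * (half + half) - (half + half) * Δ)
      ≈⟨ +-cong refl (+-cong refl (trans (-‿cong (distribʳ Δ half half)) (sym (⁻¹-∙-comm _ _)))) ⟩
    (S + S) + ((P + P) * (half + half) + (- (half * Δ) + - (half * Δ)))
      -- a semiring solver: - (half * Δ) is an atom
      ≈⟨ solve 4 (λ S P h d → (S :+ S) :+ ((P :+ P) :* (h :+ h) :+ (d :+ d))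
                             := (S :+ d) :+ (S :+ d) :+ h :* ((P :+ P) :+ (P :+ P))) refl S P half (- (half * Δ)) ⟩
    (S - half * Δ) + (S - half * Δ) + half * ((P + P) + (P + P))
      ≈⟨ +-cong (two*x≈x+x _) (*-cong refl (trans (two*x≈x+x _) (+-cong (two*x≈x+x P) (two*x≈x+x P)))) ⟨
    natC 2 * (S - half * Δ) + half * (natC 2 * (natC 2 * P)) ∎
    where
    X≈2P-Δ : X ≈ (P + P) - Δ
    X≈2P-Δ = begin
      X                ≈⟨ +-identityʳ X ⟨
      X + 0#           ≈⟨ +-cong refl (-‿inverseʳ Δ) ⟨
      X + (Δ - Δ)      ≈⟨ +-assoc X Δ (- Δ) ⟨
      (X + Δ) - Δ      ≈⟨ +-cong X+Δ≈2P refl ⟩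
      (P + P) - Δ      ∎

  inv0≈1 : inv 0 ≈ 1#
  inv0≈1 = trans (sym (*-identityˡ _)) (trans (*-cong (sym (+-identityʳ 1#)) refl) (inv-law 0))

  -- In dimension n + 2 ≥ 3 the truncated series logM and expM reach their quadratic terms.
  module _ {n′ : ℕ} where

    private
      n = suc n′

      x+[0+0]≈x : ∀ {x} → x + (0# + 0#) ≈ x
      x+[0+0]≈x = trans (+-cong refl (+-identityʳ 0#)) (+-identityʳ _)

    IsHeis-logM : ∀ {X a b c} → IsHeis {n} 1# X a b c → IsHeis 0# (logM X) a b (c - half * dot a b)
    IsHeis-logM {X} {a} {b} {c} H = IsHeis-cong (IsHeis-+M first (IsHeis-+M second rest))
      x+[0+0]≈x (λ m → x+[0+0]≈x) (λ m → x+[0+0]≈x) (+-cong refl (+-identityʳ _))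
      where
      term : ℕ → Mat (suc (suc n))
      term k = (sign k * inv k) ·M powM (X -M idM) (suc k)

      X-I : IsHeis 0# (X -M idM) a b c
      X-I = IsHeis-cong (IsHeis--M H IsHeis-idM) (-‿inverseʳ 1#) (λ m → x-0≈x) (λ m → x-0≈x) x-0≈x
        where
        x-0≈x : ∀ {x} → x - 0# ≈ x
        x-0≈x = trans (+-cong refl (trans (sym (+-identityˡ (- 0#))) (-‿inverseʳ 0#))) (+-identityʳ _)
      open Nilpotent X-I

      first : IsHeis 0# (term 0) a b c
      first = IsHeis-cong (IsHeis-·M (1# * inv 0) IsHeis-powM-1) (zeroʳ _) (λ m → 1·x≈x) (λ m → 1·x≈x) 1·x≈x
        where
        1·x≈x : ∀ {x} → (1# * inv 0) * x ≈ x
        1·x≈x = trans (*-cong (trans (*-identityˡ _) inv0≈1) refl) (*-identityˡ _)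

      second : IsHeis 0# (term 1) (λ _ → 0#) (λ _ → 0#) (- (half * dot a b))
      second = IsHeis-cong (IsHeis-·M (- 1# * half) IsHeis-powM-2) (zeroʳ _) (λ m → zeroʳ _) (λ m → zeroʳ _)
                 (trans (*-assoc _ _ _) (-1*x≈-x _))

      rest : IsHeis 0# (sumM {k = n} (λ k → term (2 ℕ.+ toℕ k))) (λ _ → 0#) (λ _ → 0#) 0#
      rest = IsHeis-resp-≈M (sumM-zero {k = n} (λ k → term (2 ℕ.+ toℕ k)) λ k →
               ·M-zero (sign (2 ℕ.+ toℕ k) * inv (2 ℕ.+ toℕ k)) (powM-vanishes (toℕ k))) IsHeis-zeroM

    IsHeis-expM : ∀ {Y a b c} → IsHeis {n} 0# Y a b c → IsHeis 1# (expM Y) a b (c + half * dot a b)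
    IsHeis-expM {Y} {a} {b} {c} H = IsHeis-cong (IsHeis-+M first (IsHeis-+M second (IsHeis-+M third rest)))
      (trans (+-cong refl 0+[0+0]≈0) (+-identityʳ 1#)) (λ m → 0+[x+[0+0]]≈x) (λ m → 0+[x+[0+0]]≈x)
      (trans (+-identityˡ _) (+-cong refl (+-identityʳ _)))
      where
      term : ℕ → Mat (suc (suc n))
      term k = invFact k ·M powM Y k
      open Nilpotent H

      first : IsHeis 1# (term 0) (λ _ → 0#) (λ _ → 0#) 0#
      first = IsHeis-cong (IsHeis-·M 1# IsHeis-idM) (*-identityˡ 1#) (λ m → zeroʳ 1#) (λ m → zeroʳ 1#) (zeroʳ 1#)

      second : IsHeis 0# (term 1) a b c
      second = IsHeis-cong (IsHeis-·M (inv 0 * 1#) IsHeis-powM-1) (zeroʳ _) (λ m → 1·x≈x) (λ m → 1·x≈x) 1·x≈x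
        where
        1·x≈x : ∀ {x} → (inv 0 * 1#) * x ≈ x
        1·x≈x = trans (*-cong (trans (*-identityʳ _) inv0≈1) refl) (*-identityˡ _)

      third : IsHeis 0# (term 2) (λ _ → 0#) (λ _ → 0#) (half * dot a b)
      third = IsHeis-cong (IsHeis-·M (half * (inv 0 * 1#)) IsHeis-powM-2)
                (zeroʳ _) (λ m → zeroʳ _) (λ m → zeroʳ _)
                (*-cong (trans (*-cong refl (trans (*-identityʳ _) inv0≈1)) (*-identityʳ half)) refl)

      rest : IsHeis 0# (sumM {k = n′} (λ k → term (3 ℕ.+ toℕ k))) (λ _ → 0#) (λ _ → 0#) 0#
      rest = IsHeis-resp-≈M (sumM-zero {k = n′} (λ k → term (3 ℕ.+ toℕ k)) λ k →
               ·M-zero (invFact (3 ℕ.+ toℕ k)) (powM-vanishes (toℕ k))) IsHeis-zeroM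

      0+[0+0]≈0 : 0# + (0# + 0#) ≈ 0#
      0+[0+0]≈0 = trans (+-identityˡ _) (+-identityˡ 0#)

      0+[x+[0+0]]≈x : ∀ {x} → 0# + (x + (0# + 0#)) ≈ x
      0+[x+[0+0]]≈x = trans (+-identityˡ _) x+[0+0]≈x

  sumL : {I : Set} → (I → Carrier) → List I → Carrier
  sumL f [] = 0#
  sumL f (x ∷ xs) = f x + sumL f xs

  sumL-++ : ∀ {I : Set} (f : I → Carrier) xs ys → sumL f (xs ++ ys) ≈ sumL f xs + sumL f ys
  sumL-++ f [] ys = sym (+-identityˡ _)
  sumL-++ f (x ∷ xs) ys = trans (+-cong refl (sumL-++ f xs ys)) (sym (+-assoc _ _ _))

  sumL-reverse : ∀ {I : Set} (f : I → Carrier) xs → sumL f (reverse xs) ≈ sumL f xs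
  sumL-reverse f [] = refl
  sumL-reverse f (x ∷ xs) rewrite unfold-reverse x xs =
    trans (sumL-++ f (reverse xs) (x ∷ [])) (trans (+-cong (sumL-reverse f xs) (+-identityʳ _)) (+-comm _ _))

  sumL-tabulate : ∀ {I : Set} {k} (f : I → Carrier) (g : Fin k → I) → sumL f (tabulate g) ≈ sumF (f ∘ g)
  sumL-tabulate {k = zero} f g = refl
  sumL-tabulate {k = suc k} f g = +-cong refl (sumL-tabulate f (g ∘ suc))

  sumLᵥ : ∀ {I : Set} {n} → (I → Vector Carrier n) → List I → Vector Carrier n
  sumLᵥ v xs m = sumL (λ x → v x m) xs

  module Product {n : ℕ} {I : Set} (A B : I → Vector Carrier n) (C : I → Carrier) where

    cross : List I → Carrier
    cross [] = 0#
    cross (x ∷ xs) = dot (A x) (sumLᵥ B xs) + cross xs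

    IsHeis-prodM : ∀ xs → IsHeis 1# (prodM (λ j → heis (A (lookup xs j)) (B (lookup xs j)) (C (lookup xs j))))
                                  (sumLᵥ A xs) (sumLᵥ B xs) (sumL C xs + cross xs)
    IsHeis-prodM [] = IsHeis-cong IsHeis-idM refl (λ m → refl) (λ m → refl) (sym (+-identityˡ 0#))
    IsHeis-prodM (x ∷ xs) = IsHeis-cong (IsHeis-*M (IsHeis-heis (A x) (B x) (C x)) (IsHeis-prodM xs))
      (*-identityˡ 1#) (λ m → 1*y+x*1≈x+y) (λ m → 1*y+x*1≈x+y)
      (trans (+-cong (+-cong (*-identityˡ _) refl) (*-identityʳ _))
        (solve 4 (λ s c d t → (s :+ c) :+ d :+ t := (t :+ s) :+ (d :+ c)) refl _ _ _ _))
      where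
      1*y+x*1≈x+y : ∀ {x y} → 1# * y + x * 1# ≈ x + y
      1*y+x*1≈x+y = trans (+-cong (*-identityˡ _) (*-identityʳ _)) (+-comm _ _)

    cross-++ : ∀ xs ys → cross (xs ++ ys) ≈ cross xs + cross ys + dot (sumLᵥ A xs) (sumLᵥ B ys)
    cross-++ [] ys = sym (trans (+-cong (+-identityˡ _) (dot-zeroˡ {n} _)) (+-identityʳ _))
    cross-++ (x ∷ xs) ys = begin
      dot (A x) (sumLᵥ B (xs ++ ys)) + cross (xs ++ ys)
        ≈⟨ +-cong (trans (dot-cong {n} ≋-refl (λ m → sumL-++ _ xs ys)) (dot-distribˡ-+ {n} _ _ _))
                  (cross-++ xs ys) ⟩
      (dot (A x) (sumLᵥ B xs) + dot (A x) (sumLᵥ B ys)) + (cross xs + cross ys + dot (sumLᵥ A xs) (sumLᵥ B ys))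
        ≈⟨ solve 5 (λ p q r s t → (p :+ q) :+ ((r :+ s) :+ t) := ((p :+ r) :+ s) :+ (q :+ t)) refl _ _ _ _ _ ⟩
      (dot (A x) (sumLᵥ B xs) + cross xs) + cross ys + (dot (A x) (sumLᵥ B ys) + dot (sumLᵥ A xs) (sumLᵥ B ys))
        ≈⟨ +-cong refl (dot-distribʳ-+ {n} _ _ _) ⟨
      cross (x ∷ xs) + cross ys + dot (sumLᵥ A (x ∷ xs)) (sumLᵥ B ys) ∎

    -- Pairs i < j and i > j in xs, together with the diagonal, make up all pairs.
    cross-reverse : ∀ xs → cross xs + cross (reverse xs) + sumL (λ x → dot (A x) (B x)) xs ≈
                           dot (sumLᵥ A xs) (sumLᵥ B xs)
    cross-reverse [] = trans (+-identityʳ _) (trans (+-identityʳ _) (sym (dot-zeroˡ {n} _)))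
    cross-reverse (x ∷ xs) rewrite unfold-reverse x xs = begin
      (dot (A x) Bs + cross xs) + cross (reverse xs ++ x ∷ []) + (dot (A x) (B x) + Δ)
        ≈⟨ +-cong (+-cong refl cross-snoc) refl ⟩
      (dot (A x) Bs + cross xs) + (cross (reverse xs) + dot As (B x)) + (dot (A x) (B x) + Δ)
        ≈⟨ solve 6 (λ p q r s t u → (p :+ q) :+ (r :+ s) :+ (t :+ u) := ((q :+ r) :+ u) :+ ((t :+ p) :+ s))
             refl _ _ _ _ _ _ ⟩
      (cross xs + cross (reverse xs) + Δ) + ((dot (A x) (B x) + dot (A x) Bs) + dot As (B x))
        ≈⟨ +-cong (cross-reverse xs) refl ⟩
      dot As Bs + ((dot (A x) (B x) + dot (A x) Bs) + dot As (B x))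
        ≈⟨ solve 4 (λ p q r s → p :+ ((q :+ r) :+ s) := (q :+ r) :+ (s :+ p)) refl _ _ _ _ ⟩
      (dot (A x) (B x) + dot (A x) Bs) + (dot As (B x) + dot As Bs)
        ≈⟨ trans (dot-distribʳ-+ (A x) As (sumLᵥ B (x ∷ xs)))
             (+-cong (dot-distribˡ-+ (A x) (B x) Bs) (dot-distribˡ-+ As (B x) Bs)) ⟨
      dot (sumLᵥ A (x ∷ xs)) (sumLᵥ B (x ∷ xs)) ∎
      where
      As Bs : Vector Carrier n
      As = sumLᵥ A xs
      Bs = sumLᵥ B xs
      Δ : Carrier
      Δ = sumL (λ y → dot (A y) (B y)) xs
      cross-snoc : cross (reverse xs ++ x ∷ []) ≈ cross (reverse xs) + dot As (B x)
      cross-snoc = trans (cross-++ (reverse xs) (x ∷ []))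
        (+-cong (trans (+-cong refl (trans (+-identityʳ _) (dot-zeroʳ {n} _))) (+-identityʳ _))
                (dot-cong {n} (λ m → sumL-reverse _ xs) (λ m → +-identityʳ _)))

    cross-palindrome : ∀ xs → cross (xs ++ reverse xs) + sumL (λ x → dot (A x) (B x)) xs ≈
                              dot (sumLᵥ A xs) (sumLᵥ B xs) + dot (sumLᵥ A xs) (sumLᵥ B xs)
    cross-palindrome xs = begin
      cross (xs ++ reverse xs) + Δ
        ≈⟨ +-cong (cross-++ xs (reverse xs)) refl ⟩
      cross xs + cross (reverse xs) + dot As (sumLᵥ B (reverse xs)) + Δ
        ≈⟨ +-cong (+-cong refl (dot-cong {n} ≋-refl (λ m → sumL-reverse _ xs))) refl ⟩
      cross xs + cross (reverse xs) + dot As Bs + Δ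
        ≈⟨ solve 4 (λ p q r s → p :+ q :+ r :+ s := (p :+ q :+ s) :+ r) refl _ _ _ _ ⟩
      cross xs + cross (reverse xs) + Δ + dot As Bs
        ≈⟨ +-cong (cross-reverse xs) refl ⟩
      dot As Bs + dot As Bs ∎
      where
      As Bs : Vector Carrier n
      As = sumLᵥ A xs
      Bs = sumLᵥ B xs
      Δ : Carrier
      Δ = sumL (λ x → dot (A x) (B x)) xs

  sumL-palindrome : ∀ {N} (f : Fin N → Carrier) → sumL f (palindrome N) ≈ sumF f + sumF f
  sumL-palindrome {N} f = trans (sumL-++ f (allFin N) (reverse (allFin N)))
    (+-cong (sumL-tabulate f (λ i → i)) (trans (sumL-reverse f (allFin N)) (sumL-tabulate f (λ i → i))))

  prodM-palindrome≈expM : ∀ {n′ N} (A B : Fin N → Vector Carrier (suc n′)) (C : Fin N → Carrier) →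
    let a = lookup (palindrome N) in
    prodM (λ j → heis (A (a j)) (B (a j)) (C (a j)))
      ≈M expM (natC 2 ·M sumM (λ i → logM (heis (A i) (B i) (C i))))
  prodM-palindrome≈expM {n′} {N} A B C = IsHeis-unique product exponential
    where
    open Product A B C
    ΣA ΣB 2ΣA 2ΣB : Vector Carrier (suc n′)
    ΣA m = sumF (λ i → A i m)
    ΣB m = sumF (λ i → B i m)
    2ΣA m = natC 2 * ΣA m
    2ΣB m = natC 2 * ΣB m
    δ : Fin N → Carrier
    δ i = dot (A i) (B i)
    c⋆ : Carrier
    c⋆ = natC 2 * sumF (λ i → C i - half * δ i) + half * dot 2ΣA 2ΣB

    exponential : IsHeis 1# (expM (natC 2 ·M sumM (λ i → logM (heis (A i) (B i) (C i))))) 2ΣA 2ΣB c⋆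
    exponential = IsHeis-expM (IsHeis-cong (IsHeis-·M (natC 2) (IsHeis-sumM _ A B _ λ i →
                    IsHeis-logM (IsHeis-heis (A i) (B i) (C i)))) (zeroʳ _) ≋-refl ≋-refl refl)

    cross+Δ≈2P : cross (palindrome N) + sumF δ ≈ dot ΣA ΣB + dot ΣA ΣB
    cross+Δ≈2P = trans (+-cong refl (sym (sumL-tabulate δ (λ i → i))))
      (trans (cross-palindrome (allFin N)) (+-cong ΣAB≈ ΣAB≈))
      where
      ΣAB≈ : dot (sumLᵥ A (allFin N)) (sumLᵥ B (allFin N)) ≈ dot ΣA ΣB
      ΣAB≈ = dot-cong {suc n′} (λ m → sumL-tabulate (λ x → A x m) (λ i → i))
                                (λ m → sumL-tabulate (λ x → B x m) (λ i → i))

    c-coordinate : sumL C (palindrome N) + cross (palindrome N) ≈ c⋆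
    c-coordinate = begin
      sumL C (palindrome N) + cross (palindrome N)
        ≈⟨ +-cong (sumL-palindrome C) refl ⟩
      (sumF C + sumF C) + cross (palindrome N)
        ≈⟨ halving-identity cross+Δ≈2P ⟩
      natC 2 * (sumF C - half * sumF δ) + half * (natC 2 * (natC 2 * dot ΣA ΣB))
        ≈⟨ +-cong (*-cong refl linear)
                  (*-cong refl (trans (dot-*ˡ (natC 2) ΣA 2ΣB) (*-cong refl (dot-*ʳ (natC 2) ΣA ΣB)))) ⟨
      c⋆ ∎
      where
      linear : sumF (λ i → C i - half * δ i) ≈ sumF C - half * sumF δ
      linear = trans (sumF-distrib-+ C (λ i → - (half * δ i)))
        (+-cong refl (trans (sym (-‿distrib-sumF {N} (λ i → half * δ i)))
                            (-‿cong (sym (*-distribˡ-sumF half δ)))))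

    product : IsHeis 1# (prodM (λ j → heis (A (lookup (palindrome N) j)) (B (lookup (palindrome N) j))
                                            (C (lookup (palindrome N) j)))) 2ΣA 2ΣB c⋆
    product = IsHeis-cong (IsHeis-prodM (palindrome N)) refl
      (λ m → trans (sumL-palindrome (λ x → A x m)) (sym (two*x≈x+x _)))
      (λ m → trans (sumL-palindrome (λ x → B x m)) (sym (two*x≈x+x _)))
      c-coordinate

open import Data.Nat.Base using (_+_; _*_; _≤_; z≤n; s≤s)
open import Data.Nat.Properties using (+-identityʳ)
open ≡ using (refl; cong; sym; trans)

occurrences : ∀ {N} → Fin N → List (Fin N) → ℕ
occurrences i xs = length (filter (_≟ i) xs)

occurrences-map : ∀ {A : Set} {N} (f : A → Fin N) i xs →
  length (filter (λ x → f x ≟ i) xs) ≡ occurrences i (map f xs)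
occurrences-map f i [] = refl
occurrences-map f i (x ∷ xs) with does (f x ≟ i)
... | true = cong suc (occurrences-map f i xs)
... | false = occurrences-map f i xs

count-lookup : ∀ {N} (xs : List (Fin N)) i → count (lookup xs) i ≡ occurrences i xs
count-lookup xs i = trans (occurrences-map (lookup xs) i (allFin (length xs)))
  (cong (occurrences i) (trans (map-tabulate (λ j → j) (lookup xs)) (tabulate-lookup xs)))

occurrences-++ : ∀ {N} (i : Fin N) xs ys → occurrences i (xs ++ ys) ≡ occurrences i xs + occurrences i ys
occurrences-++ i xs ys = trans (cong length (filter-++ (_≟ i) xs ys)) (length-++ (filter (_≟ i) xs))

occurrences-reverse : ∀ {N} (i : Fin N) xs → occurrences i (reverse xs) ≡ occurrences i xs
occurrences-reverse i xs = ↭-length (filter-↭ (_≟ i) (↭-reverse xs))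

occurrences-zero-map-suc : ∀ {N} (xs : List (Fin N)) → occurrences zero (map suc xs) ≡ 0
occurrences-zero-map-suc [] = refl
occurrences-zero-map-suc (x ∷ xs) = occurrences-zero-map-suc xs

occurrences-suc-map-suc : ∀ {N} (i : Fin N) xs → occurrences (suc i) (map suc xs) ≡ occurrences i xs
occurrences-suc-map-suc i [] = refl
occurrences-suc-map-suc i (x ∷ xs) with does (x ≟ i)
... | true = cong suc (occurrences-suc-map-suc i xs)
... | false = occurrences-suc-map-suc i xs

allFin-suc : ∀ N → allFin (suc N) ≡ zero ∷ map suc (allFin N)
allFin-suc N = cong (zero ∷_) (sym (map-tabulate (λ j → j) suc))

occurrences-allFin : ∀ N (i : Fin N) → occurrences i (allFin N) ≡ 1
occurrences-allFin (suc N) zero = trans (cong (occurrences zero) (allFin-suc N))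
  (cong suc (occurrences-zero-map-suc (allFin N)))
occurrences-allFin (suc N) (suc i) = trans (cong (occurrences (suc i)) (allFin-suc N))
  (trans (occurrences-suc-map-suc i (allFin N)) (occurrences-allFin N i))

length-palindrome : ∀ N → length (palindrome N) ≡ 2 * N
length-palindrome N = trans (length-++ (allFin N))
  (trans (cong (length (allFin N) +_) (length-reverse (allFin N)))
    (trans (cong (λ k → k + k) (length-tabulate {n = N} (λ i → i))) (cong (N +_) (sym (+-identityʳ N)))))

occurrences-palindrome : ∀ N (i : Fin N) → occurrences i (palindrome N) ≡ 2
occurrences-palindrome N i = trans (occurrences-++ i (allFin N) (reverse (allFin N)))
  (trans (cong (occurrences i (allFin N) +_) (occurrences-reverse i (allFin N)))
    (cong (λ k → k + k) (occurrences-allFin N i)))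

count-palindrome : ∀ N (i : Fin N) → count (lookup (palindrome N)) i ≡ 2
count-palindrome N i = trans (count-lookup (palindrome N) i) (occurrences-palindrome N i)

proposition3p2 : ∀ {c ℓ} (R : QAlgebra c ℓ) (N : ℕ) → 1 ≤ N →
    Σ ℕ λ M → Σ ℕ λ q → Σ (Fin M → Fin N) λ a →
      1 ≤ M × M ≡ q * N × (∀ i → count a i ≡ q) ×
      (∀ (n : ℕ) → 1 ≤ n →
        ∀ (A B : Fin N → Fin n → CommutativeRing.Carrier (QAlgebra.ring R))
          (C : Fin N → CommutativeRing.Carrier (QAlgebra.ring R)) →
        Over._≈M_ R
          (Over.prodM R (λ j → Over.heis R (A (a j)) (B (a j)) (C (a j))))
          (Over.expM R (Over._·M_ R (QAlgebra.natC R q)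
            (Over.sumM R (λ i → Over.logM R (Over.heis R (A i) (B i) (C i)))))))
proposition3p2 R (suc N) _ =
  length (palindrome (suc N)) , 2 , lookup (palindrome (suc N)) ,
  s≤s z≤n , length-palindrome (suc N) , count-palindrome (suc N) ,
  λ { (suc n′) _ A B C → Heisenberg.prodM-palindrome≈expM R A B C }
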